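{- Fix $k\ge2$. Let $p$ be a full rook placement on a Ferrers board containing $k\cdots21$, with B-sequence $b_k\cdots b_1$, and let $1\le i\le j<k$. Then in (the permutation associated with) $\psi(p)$, the maximum length of a decreasing subsequence starting at the value $b_j$ and ending at the value $b_i$ is $j-i+1$ (one such subsequence being $b_jb_{j-1}\cdots b_i$).
   Context: A Ferrers board $\lambda$ is a finite set of cells $(i,j)$ ($i$ = column, $j$ = row) closed under decreasing either coordinate. A full rook placement on $\lambda$ is a set of cells (dots) with one dot per row and per column; its permutation $\pi$ has $\pi(i)=j$ iff $(i,j)$ is a dot, and dots are identified with their values. An occurrence of $k\cdots21$ in $p$ is a set of dots at positions $i_1<\cdots<i_k$ with $\pi_{i_1}>\cdots>\pi_{i_k}$ and $(i_k,\pi_{i_1})\in\lambda$. The B-sequence $b_k\cdots b_1$: $b_1$ is the leftmost dot ending an occurrence of $k\cdots21$, and for $j\ge2$, $b_j$ is the leftmost dot such that $b_j\cdots b_1$ ends an occurrence. The B-shift $\psi(p)$ places the values $b_{k-1},\ldots,b_1,b_k$ at the positions previously occupied by $b_k,\ldots,b_2,b_1$ respectively, other dots unchanged. -}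

module Defs where

open import Data.Nat using (ℕ; zero; suc; _+_; _∸_) renaming (_≤_ to _≤ℕ_; _<_ to _<ℕ_)
open import Data.Fin using (Fin; _≟_) renaming (_≤_ to _≤F_; _<_ to _<F_)
open import Data.Product using (Σ; ∃; _×_)
open import Data.Maybe using (Maybe; just; nothing)
open import Relation.Binary.PropositionalEquality using (_≡_)
open import Relation.Nullary using (yes; no)
open import Function.Definitions using (Injective)

-- Conventions: a full rook placement has n columns and n rows, so the board
-- is a set of cells (i , j) ⊆ Fin n × Fin n (i = column, j = row), 0-indexed.
record Board (n : ℕ) : Set₁ where
  field
    cell : Fin n → Fin n → Set
    down : ∀ {i j i′ j′} → i′ ≤F i → j′ ≤F j → cell i j → cell i′ j′
open Board public

-- A full rook placement on B, given by its permutation π (π i = j iff (i , j) is a dot):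
-- one dot per column (π a function), one dot per row (π injective, hence bijective),
-- all dots are cells of B.
record IsFullRook {n : ℕ} (B : Board n) (π : Fin n → Fin n) : Set where
  field
    inj    : Injective _≡_ _≡_ π
    onBoard : ∀ i → cell B i (π i)

-- An occurrence of k⋯21 in π: positions s 1 < ⋯ < s k (sequences indexed 1..k by ℕ)
-- with decreasing values and (s k , π (s 1)) ∈ B.
IsOcc : {n : ℕ} → Board n → (Fin n → Fin n) → ℕ → (ℕ → Fin n) → Set
IsOcc B π k s =
  (∀ a c → 1 ≤ℕ a → a <ℕ c → c ≤ℕ k → (s a <F s c) × (π (s c) <F π (s a)))
  × cell B (s k) (π (s 1))

-- "x b_{j-1} ⋯ b_1 ends an occurrence of k⋯21": there is an occurrence whose
-- last j dots are x, b (j-1), …, b 1 (dots given by their positions).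
EndsOcc : {n : ℕ} → Board n → (Fin n → Fin n) → ℕ → ℕ → Fin n → (ℕ → Fin n) → Set
EndsOcc B π k j x b = ∃ λ s → IsOcc B π k s × (s (suc k ∸ j) ≡ x)
  × (∀ t → 1 ≤ℕ t → t <ℕ j → s (suc k ∸ t) ≡ b t)

-- b (given by positions, indexed 1..k) is the B-sequence b_k ⋯ b_1 of π:
-- each b j is the leftmost dot x such that x b_{j-1} ⋯ b_1 ends an occurrence.
IsBSeq : {n : ℕ} → Board n → (Fin n → Fin n) → ℕ → (ℕ → Fin n) → Set
IsBSeq B π k b = ∀ j → 1 ≤ℕ j → j ≤ℕ k →
  EndsOcc B π k j (b j) b × (∀ x → EndsOcc B π k j x b → b j ≤F x)

findIdx : {n : ℕ} → (ℕ → Fin n) → Fin n → ℕ → Maybe ℕ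
findIdx b x zero = nothing
findIdx b x (suc m) with b (suc m) ≟ x
... | yes _ = just (suc m)
... | no _ = findIdx b x m

shiftVal : {n : ℕ} → (Fin n → Fin n) → ℕ → (ℕ → Fin n) → Fin n → Maybe ℕ → Fin n
shiftVal π k b x nothing = π x
shiftVal π k b x (just zero) = π x
shiftVal π k b x (just (suc zero)) = π (b k)
shiftVal π k b x (just (suc (suc m))) = π (b (suc m))

-- The B-shift ψ: the value π (b (m-1)) is placed at position b m (2 ≤ m ≤ k),
-- the value π (b k) at position b 1; all other dots unchanged.
ψ : {n : ℕ} → (Fin n → Fin n) → ℕ → (ℕ → Fin n) → (Fin n → Fin n)
ψ π k b x = shiftVal π k b x (findIdx b x k)

IsDecFromTo : {n : ℕ} → (Fin n → Fin n) → Fin n → Fin n → ℕ → (ℕ → Fin n) → Set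
IsDecFromTo σ v w L q = 1 ≤ℕ L
  × (∀ a c → 1 ≤ℕ a → a <ℕ c → c ≤ℕ L → (q a <F q c) × (σ (q c) <F σ (q a)))
  × σ (q 1) ≡ v × σ (q L) ≡ w

MaxDecLength : {n : ℕ} → (Fin n → Fin n) → Fin n → Fin n → ℕ → Set
MaxDecLength σ v w L = (∃ λ q → IsDecFromTo σ v w L q)
  × (∀ L′ q → IsDecFromTo σ v w L′ q → L′ ≤ℕ L)

-- Call a π-decreasing sequence of dots whose first value v satisfies (b₁ , v) ∈ λ
-- a chain.  Every b_t ends a chain of k + 1 − t dots, namely the prefix of the
-- occurrence that witnesses b_t; conversely, since b_m is leftmost, no chain of
-- k + 1 − m dots ends strictly left of b_m at a value above b_{m−1}, for it
-- would extend by b_{m−1} ⋯ b₁ to an occurrence.  In ψ(p) the value b_t sits at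
-- position b_{t+1}, so b_j ⋯ b_i is a decreasing run of length j − i + 1.  For
-- any decreasing subsequence of ψ(p) starting at the value b_j, its (u+1)-st dot
-- is dominated (weakly to the right, weakly below) by the end of a chain of
-- k − j + u dots; if the subsequence reached the value b_i after more than
-- j − i + 1 dots, this chain would contradict the leftmost choice of b_i.
module Submission where

open import Defs
open import Data.Nat using (ℕ; zero; suc; _∸_; _≤_; _<_; _+_; z≤n; s≤s; _≤?_)
open import Data.Nat.Properties hiding (_≟_)
open import Data.Fin using (Fin; toℕ; _≟_) renaming (_≤_ to _≤F_; _<_ to _<F_)
open import Data.Product using (∃; _×_; _,_; proj₁; proj₂)
open import Data.Sum using (inj₁; inj₂; [_,_]′)
open import Data.Maybe using (Maybe; just; nothing)
open import Data.Empty using (⊥; ⊥-elim)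
open import Function using (_∘_)
open import Function.Definitions using (Injective)
open import Relation.Nullary using (¬_; yes; no)
open import Relation.Binary.PropositionalEquality
open import Relation.Binary.Definitions using (tri<; tri≈; tri>)

Inversion : ∀ {n} → (Fin n → Fin n) → Fin n → Fin n → Set
Inversion σ x y = x <F y × σ y <F σ x

WeakInversion : ∀ {n} → (Fin n → Fin n) → Fin n → Fin n → Set
WeakInversion σ x y = x ≤F y × σ y ≤F σ x

DecreasingOn : ∀ {n} → (Fin n → Fin n) → (ℕ → Fin n) → ℕ → ℕ → Set
DecreasingOn σ d lo hi = ∀ a c → lo ≤ a → a < c → c ≤ hi → Inversion σ (d a) (d c)

splice : {A : Set} → ℕ → (ℕ → A) → (ℕ → A) → ℕ → A
splice N d e a with a ≤? N
... | yes _ = d a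
... | no _ = e a

splice-≤ : ∀ {A : Set} {N a} (d e : ℕ → A) → a ≤ N → splice N d e a ≡ d a
splice-≤ {N = N} {a} d e a≤N with a ≤? N
... | yes _ = refl
... | no a≰N = ⊥-elim (a≰N a≤N)

splice-> : ∀ {A : Set} {N a} (d e : ℕ → A) → N < a → splice N d e a ≡ e a
splice-> {N = N} {a} d e N<a with a ≤? N
... | yes a≤N = ⊥-elim (<⇒≱ N<a a≤N)
... | no _ = refl

module _ {n : ℕ} (σ : Fin n → Fin n) where

  inversion-between : ∀ {x y z w} → WeakInversion σ x y → Inversion σ y z →
                      WeakInversion σ z w → Inversion σ x w
  inversion-between (x≤y , σy≤σx) (y<z , σz<σy) (z≤w , σw≤σz) =
    ≤-<-trans x≤y (<-≤-trans y<z z≤w) , ≤-<-trans σw≤σz (<-≤-trans σz<σy σy≤σx)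

  decreasingOn-weak : ∀ d {lo hi a c} → DecreasingOn σ d lo hi →
                      lo ≤ a → a ≤ c → c ≤ hi → WeakInversion σ (d a) (d c)
  decreasingOn-weak d dec lo≤a a≤c c≤hi with m≤n⇒m<n∨m≡n a≤c
  ... | inj₂ refl = ≤-refl , ≤-refl
  ... | inj₁ a<c = let (x<y , σy<σx) = dec _ _ lo≤a a<c c≤hi in <⇒≤ x<y , <⇒≤ σy<σx

  decreasingOn-narrow : ∀ d {lo lo′ hi hi′} → lo ≤ lo′ → hi′ ≤ hi →
                        DecreasingOn σ d lo hi → DecreasingOn σ d lo′ hi′
  decreasingOn-narrow d lo≤lo′ hi′≤hi dec a c lo′≤a a<c c≤hi′ =
    dec a c (≤-trans lo≤lo′ lo′≤a) a<c (≤-trans c≤hi′ hi′≤hi)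

  decreasingOn-splice : ∀ d e {lo N hi} → DecreasingOn σ d lo N →
                        DecreasingOn σ e (suc N) hi →
                        (N < hi → Inversion σ (d N) (e (suc N))) →
                        DecreasingOn σ (splice N d e) lo hi
  decreasingOn-splice d e {N = N} decd dece join a c lo≤a a<c c≤hi with a ≤? N | c ≤? N
  ... | yes _   | yes c≤N = decd a c lo≤a a<c c≤N
  ... | yes a≤N | no c≰N  =
    inversion-between (decreasingOn-weak d decd lo≤a a≤N ≤-refl)
                      (join (<-≤-trans (≰⇒> c≰N) c≤hi))
                      (decreasingOn-weak e dece ≤-refl (≰⇒> c≰N) c≤hi)
  ... | no a≰N  | yes c≤N = ⊥-elim (a≰N (≤-trans (<⇒≤ a<c) c≤N))
  ... | no a≰N  | no _    = dece a c (≰⇒> a≰N) a<c c≤hi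

module Chains {n} (B : Board n) (π : Fin n → Fin n) (root : Fin n) where

  record Chain (g : ℕ) (y : Fin n) : Set where
    field
      dots       : ℕ → Fin n
      decreasing : DecreasingOn π dots 1 (suc g)
      last       : dots (suc g) ≡ y
      rooted     : cell B root (π (dots 1))

  chain-prefix : ∀ {s M} g → DecreasingOn π s 1 M → cell B root (π (s 1)) →
                 suc g ≤ M → Chain g (s (suc g))
  chain-prefix {s} g dec rooted sg≤M = record
    { dots = s
    ; decreasing = decreasingOn-narrow π s ≤-refl sg≤M dec
    ; last = refl
    ; rooted = rooted
    }

  chain-shorten : ∀ {g g′ y} → g ≤ g′ → Chain g′ y → Chain g y
  chain-shorten {g} {g′} g≤g′ ch = record
    { dots = λ a → dots (a + δ)
    ; decreasing = λ a c 1≤a a<c c≤sg →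
        decreasing (a + δ) (c + δ) (≤-trans 1≤a (m≤m+n a δ)) (+-monoˡ-< δ a<c)
          (subst (c + δ ≤_) (cong suc g+δ≡g′) (+-monoˡ-≤ δ c≤sg))
    ; last = trans (cong (dots ∘ suc) g+δ≡g′) last
    ; rooted = down B ≤-refl
        (proj₂ (decreasingOn-weak π dots decreasing ≤-refl (s≤s z≤n) (s≤s (m∸n≤m g′ g))))
        rooted
    }
    where
    open Chain ch
    δ : ℕ
    δ = g′ ∸ g
    g+δ≡g′ : g + δ ≡ g′
    g+δ≡g′ = m+[n∸m]≡n g≤g′

  chain-snoc : ∀ {g y z} → Chain g y → Inversion π y z → Chain (suc g) z
  chain-snoc {g} {z = z} ch y⋯z = record
    { dots = splice (suc g) dots (λ _ → z)
    ; decreasing = decreasingOn-splice π dots (λ _ → z) decreasing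
        (λ a c ssg≤a a<c c≤ssg → ⊥-elim (<⇒≱ a<c (≤-trans c≤ssg ssg≤a)))
        (λ _ → subst (λ w → Inversion π w z) (sym last) y⋯z)
    ; last = splice-> {N = suc g} dots (λ _ → z) ≤-refl
    ; rooted = subst (λ w → cell B root (π w))
                 (sym (splice-≤ {N = suc g} dots (λ _ → z) (s≤s z≤n))) rooted
    }
    where open Chain ch

data FindIdxSpec {n} (b : ℕ → Fin n) (x : Fin n) (m : ℕ) : Maybe ℕ → Set where
  found  : ∀ {r} → 1 ≤ r → r ≤ m → b r ≡ x → FindIdxSpec b x m (just r)
  absent : (∀ r → 1 ≤ r → r ≤ m → b r ≢ x) → FindIdxSpec b x m nothing

findIdx-spec : ∀ {n} (b : ℕ → Fin n) x m → FindIdxSpec b x m (findIdx b x m)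
findIdx-spec b x zero = absent λ r 1≤r r≤0 → ⊥-elim (<⇒≱ 1≤r r≤0)
findIdx-spec b x (suc m) with b (suc m) ≟ x
... | yes bm≡x = found (s≤s z≤n) ≤-refl bm≡x
... | no bm≢x with findIdx b x m | findIdx-spec b x m
...   | just _  | found 1≤r r≤m br≡x = found 1≤r (m≤n⇒m≤1+n r≤m) br≡x
...   | nothing | absent none = absent λ r 1≤r r≤sm br≡x →
        [ (λ r<sm → none r 1≤r (≤-pred r<sm) br≡x) , (λ { refl → bm≢x br≡x }) ]′
          (m≤n⇒m<n∨m≡n r≤sm)

module BSequence {n} (B : Board n) (π : Fin n → Fin n) (k : ℕ) (1≤k : 1 ≤ k)
                 (b : ℕ → Fin n) (isBSeq : IsBSeq B π k b) where

  open Chains B π (b 1)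

  ψ′ : Fin n → Fin n
  ψ′ = ψ π k b

  endsOcc-last : ∀ t → 1 ≤ t → (E : EndsOcc B π k t (b t) b) → proj₁ E k ≡ b 1
  endsOcc-last (suc zero)    _ (_ , _ , s≡b1 , _) = s≡b1
  endsOcc-last (suc (suc t)) _ (_ , _ , _ , s≡b)  = s≡b 1 (s≤s z≤n) (s≤s (s≤s z≤n))

  occₖ : ℕ → Fin n
  occₖ = proj₁ (proj₁ (isBSeq k 1≤k ≤-refl))

  occₖ-decreasing : DecreasingOn π occₖ 1 k
  occₖ-decreasing = proj₁ (proj₁ (proj₂ (proj₁ (isBSeq k 1≤k ≤-refl))))

  occₖ-b : ∀ t → 1 ≤ t → t ≤ k → occₖ (suc k ∸ t) ≡ b t
  occₖ-b t 1≤t t≤k with m≤n⇒m<n∨m≡n t≤k | proj₁ (isBSeq k 1≤k ≤-refl)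
  ... | inj₁ t<k  | _ , _ , _ , s≡b = s≡b t 1≤t t<k
  ... | inj₂ refl | _ , _ , s≡bk , _ = s≡bk

  b-decreasing : ∀ t t′ → 1 ≤ t → t < t′ → t′ ≤ k → Inversion π (b t′) (b t)
  b-decreasing (suc t) t′ 1≤t t<t′ t′≤k =
    subst₂ (Inversion π) (occₖ-b t′ (≤-trans 1≤t (<⇒≤ t<t′)) t′≤k)
                         (occₖ-b (suc t) 1≤t (≤-trans (<⇒≤ t<t′) t′≤k))
      (occₖ-decreasing (suc k ∸ t′) (k ∸ t) (m<n⇒0<n∸m (s≤s t′≤k))
                     (∸-monoʳ-< t<t′ (m≤n⇒m≤1+n t′≤k)) (m∸n≤m k t))

  b-injective : ∀ {t t′} → 1 ≤ t → t ≤ k → 1 ≤ t′ → t′ ≤ k → b t ≡ b t′ → t ≡ t′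
  b-injective {t} {t′} 1≤t t≤k 1≤t′ t′≤k bt≡bt′ with <-cmp t t′
  ... | tri< t<t′ _ _ =
    ⊥-elim (<-irrefl (cong toℕ (sym bt≡bt′)) (proj₁ (b-decreasing t t′ 1≤t t<t′ t′≤k)))
  ... | tri≈ _ t≡t′ _ = t≡t′
  ... | tri> _ _ t′<t =
    ⊥-elim (<-irrefl (cong toℕ bt≡bt′) (proj₁ (b-decreasing t′ t 1≤t′ t′<t t≤k)))

  chain-at-b : ∀ {g} t → 1 ≤ t → t ≤ k → g + t ≤ k → Chain g (b t)
  chain-at-b {g} t 1≤t t≤k g+t≤k with proj₁ (isBSeq t 1≤t t≤k)
  ... | E@(s , (dec , corner) , s≡bt , _) =
    chain-shorten (m+n≤o⇒m≤o∸n g g+t≤k)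
      (subst (Chain (k ∸ t)) (trans (cong s (sym (+-∸-assoc 1 t≤k))) s≡bt)
        (chain-prefix (k ∸ t) dec
          (subst (λ x → cell B x (π (s 1))) (endsOcc-last t 1≤t E) corner)
          (∸-monoʳ-< 1≤t t≤k)))

  -- The chain followed by b_m ⋯ b₁.
  chain-endsOcc : ∀ {g y} m → g + suc m ≡ k → Chain g y → y <F b (suc m) →
                  (1 ≤ m → π (b m) <F π y) → EndsOcc B π k (suc m) y b
  chain-endsOcc {g} {y} m g+sm≡k ch y<b above =
    s , (s-decreasing , s-rooted) , s-at-chain-end , s-on-b
    where
    open Chain ch
    s : ℕ → Fin n
    s = splice (suc g) dots occₖ
    m<k : m < k
    m<k = subst (suc m ≤_) g+sm≡k (m≤n+m (suc m) g)
    gap : k ∸ m ≡ suc g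
    gap = trans (cong (_∸ m) (trans (sym g+sm≡k) (+-suc g m))) (m+n∸n≡m (suc g) m)
    s-at-chain-end : s (k ∸ m) ≡ y
    s-at-chain-end = trans (cong s gap) (trans (splice-≤ dots occₖ ≤-refl) last)
    s-on-b : ∀ t → 1 ≤ t → t < suc m → s (suc k ∸ t) ≡ b t
    s-on-b t 1≤t t<sm =
      trans (splice-> dots occₖ (subst (_< suc k ∸ t) gap (∸-monoʳ-< t<sm (s≤s (<⇒≤ m<k)))))
            (occₖ-b t 1≤t (≤-trans (≤-pred t<sm) (<⇒≤ m<k)))
    join : suc g < k → Inversion π (dots (suc g)) (occₖ (suc (suc g)))
    join sg<k = subst₂ (Inversion π) (sym last) (sym occₖ-next)
                  (<-trans y<b (proj₁ b-step) , above 1≤m)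
      where
      1≤m : 1 ≤ m
      1≤m = n≢0⇒n>0 λ m≡0 → <-irrefl (sym (subst (λ h → k ∸ h ≡ suc g) m≡0 gap)) sg<k
      b-step : Inversion π (b (suc m)) (b m)
      b-step = b-decreasing m (suc m) 1≤m ≤-refl m<k
      occₖ-next : occₖ (suc (suc g)) ≡ b m
      occₖ-next = trans (cong occₖ (sym (trans (+-∸-assoc 1 (<⇒≤ m<k)) (cong suc gap))))
                      (occₖ-b m 1≤m (<⇒≤ m<k))
    s-decreasing : DecreasingOn π s 1 k
    s-decreasing = decreasingOn-splice π dots occₖ decreasing
                     (decreasingOn-narrow π occₖ (s≤s z≤n) ≤-refl occₖ-decreasing) join
    s-left-of-b : ∀ t → 1 ≤ t → t ≤ suc m → s (suc k ∸ t) ≤F b t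
    s-left-of-b t 1≤t t≤sm with m≤n⇒m<n∨m≡n t≤sm
    ... | inj₁ t<sm = ≤-reflexive (cong toℕ (s-on-b t 1≤t t<sm))
    ... | inj₂ refl = ≤-trans (≤-reflexive (cong toℕ s-at-chain-end)) (<⇒≤ y<b)
    s-rooted : cell B (s k) (π (s 1))
    s-rooted = down B (s-left-of-b 1 ≤-refl (s≤s z≤n))
                 (≤-reflexive (cong (toℕ ∘ π) (splice-≤ {N = suc g} dots occₖ (s≤s z≤n))))
                 rooted

  b-leftmost : ∀ {g y} m → m < k → k ≤ g + suc m → Chain g y → y <F b (suc m) →
               (1 ≤ m → π (b m) <F π y) → ⊥
  b-leftmost {g} m m<k k≤g+sm ch y<b above =
    <⇒≱ y<b (proj₂ (isBSeq (suc m) (s≤s z≤n) m<k) _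
      (chain-endsOcc m (m∸n+n≡m m<k) (chain-shorten short ch) y<b above))
    where
    short : k ∸ suc m ≤ g
    short = m≤n+o⇒m∸n≤o k (suc m) (subst (k ≤_) (+-comm g (suc m)) k≤g+sm)

  data ψ-View (x : Fin n) : Set where
    unmoved : (∀ r → 1 ≤ r → r ≤ k → b r ≢ x) → ψ′ x ≡ π x → ψ-View x
    first   : b 1 ≡ x → ψ′ x ≡ π (b k) → ψ-View x
    later   : ∀ r → 1 ≤ r → r < k → b (suc r) ≡ x → ψ′ x ≡ π (b r) → ψ-View x

  ψ-view : ∀ x → ψ-View x
  ψ-view x = classify (findIdx-spec b x k) refl
    where
    classify : ∀ {mr} → FindIdxSpec b x k mr → ψ′ x ≡ shiftVal π k b x mr → ψ-View x
    classify (absent none) ψx≡ = unmoved none ψx≡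
    classify (found {suc zero} _ _ b1≡x) ψx≡ = first b1≡x ψx≡
    classify (found {suc (suc r)} _ r<k bsr≡x) ψx≡ = later (suc r) (s≤s z≤n) r<k bsr≡x ψx≡

  ψ-b-suc : ∀ r → 1 ≤ r → r < k → ψ′ (b (suc r)) ≡ π (b r)
  ψ-b-suc r 1≤r r<k with ψ-view (b (suc r))
  ... | unmoved none _ = ⊥-elim (none (suc r) (s≤s z≤n) r<k refl)
  ... | first b1≡ _ =
    ⊥-elim (<⇒≱ (s≤s 1≤r) (≤-reflexive (sym (b-injective ≤-refl 1≤k (s≤s z≤n) r<k b1≡))))
  ... | later r′ _ r′<k b≡ ψ≡ =
    trans ψ≡ (cong (π ∘ b) (suc-injective (b-injective (s≤s z≤n) r′<k (s≤s z≤n) r<k b≡)))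

  ψ-preimage : Injective _≡_ _≡_ π →
               ∀ {x} t → 1 ≤ t → t < k → ψ′ x ≡ π (b t) → x ≡ b (suc t)
  ψ-preimage π-inj {x} t 1≤t t<k ψx≡ with ψ-view x
  ... | unmoved none ψ≡ = ⊥-elim (none t 1≤t (<⇒≤ t<k) (sym (π-inj (trans (sym ψ≡) ψx≡))))
  ... | first _ ψ≡ =
    ⊥-elim (<-irrefl (b-injective 1≤t (<⇒≤ t<k) 1≤k ≤-refl (π-inj (trans (sym ψx≡) ψ≡))) t<k)
  ... | later r 1≤r r<k b≡ ψ≡ =
    trans (sym b≡) (cong (b ∘ suc)
      (b-injective 1≤r (<⇒≤ r<k) 1≤t (<⇒≤ t<k) (π-inj (trans (sym ψ≡) ψx≡))))

  ChainBehind : ℕ → Fin n → Set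
  ChainBehind g x = ∃ λ y → Chain g y × y ≤F x × ψ′ x ≤F π y

  chainBehind-step : ∀ {g x x′} → ChainBehind g x → Inversion ψ′ x x′ →
                     ψ′ x′ <F π (b k) → ChainBehind (suc g) x′
  chainBehind-step {g} {x} {x′} (y , ch , y≤x , ψx≤πy) (x<x′ , ψx′<ψx) ψx′<top
    with ψ-view x′
  ... | unmoved _ ψ≡ =
    x′ , chain-snoc ch (≤-<-trans y≤x x<x′ , subst (_<F π y) ψ≡ (<-≤-trans ψx′<ψx ψx≤πy))
       , ≤-refl , ≤-reflexive (cong toℕ ψ≡)
  ... | first _ ψ≡ = ⊥-elim (<-irrefl (cong toℕ ψ≡) ψx′<top)
  ... | later r 1≤r r<k b≡ ψ≡ with suc g + suc r ≤? k
  ...   | yes fits =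
    x′ , subst (Chain (suc g)) b≡ (chain-at-b (suc r) (s≤s z≤n) r<k fits) , ≤-refl
       , subst₂ _≤F_ (sym ψ≡) (cong π b≡)
           (<⇒≤ (proj₂ (b-decreasing r (suc r) 1≤r ≤-refl r<k)))
  ...   | no too-long =
    ⊥-elim (b-leftmost r r<k (≤-pred (≰⇒> too-long)) ch
             (≤-<-trans y≤x (subst (x <F_) (sym b≡) x<x′))
             (λ _ → subst (_<F π y) ψ≡ (<-≤-trans ψx′<ψx ψx≤πy)))

  chainBehind-along : ∀ {g L} q → DecreasingOn ψ′ q 1 L → ψ′ (q 1) <F π (b k) →
                      ChainBehind g (q 1) → ∀ u → suc u ≤ L → ChainBehind (g + u) (q (suc u))
  chainBehind-along {g} q _ _ start zero _ =
    subst (λ h → ChainBehind h (q 1)) (sym (+-identityʳ g)) start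
  chainBehind-along {g} q dec top start (suc u) ssu≤L =
    subst (λ h → ChainBehind h (q (suc (suc u)))) (sym (+-suc g u))
      (chainBehind-step (chainBehind-along q dec top start u (≤-trans (n≤1+n _) ssu≤L))
        (dec (suc u) (suc (suc u)) (s≤s z≤n) ≤-refl ssu≤L)
        (<-trans (proj₂ (dec 1 (suc (suc u)) ≤-refl (s≤s (s≤s z≤n)) ssu≤L)) top))

  b-run : ∀ i j → 1 ≤ i → i ≤ j → j < k →
          ∃ λ q → IsDecFromTo ψ′ (π (b j)) (π (b i)) (suc (j ∸ i)) q
  b-run i j 1≤i i≤j j<k = q , s≤s z≤n , q-decreasing , ψq (s≤s z≤n) (s≤s z≤n) , q-ends
    where
    L : ℕ
    L = suc (j ∸ i)
    T : ℕ → ℕ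
    T a = suc j ∸ a
    q : ℕ → Fin n
    q a = b (suc (T a))
    i≤T : ∀ {a} → a ≤ L → i ≤ T a
    i≤T {a} a≤L = subst (_≤ T a) (m∸[m∸n]≡n i≤j) (∸-monoʳ-≤ (suc j) a≤L)
    T<k : ∀ {a} → 1 ≤ a → T a < k
    T<k 1≤a = ≤-<-trans (∸-monoʳ-≤ (suc j) 1≤a) j<k
    ψq : ∀ {a} → 1 ≤ a → a ≤ L → ψ′ (q a) ≡ π (b (T a))
    ψq {a} 1≤a a≤L = ψ-b-suc (T a) (≤-trans 1≤i (i≤T a≤L)) (T<k 1≤a)
    q-decreasing : DecreasingOn ψ′ q 1 L
    q-decreasing a c 1≤a a<c c≤L =
      proj₁ (b-decreasing (suc (T c)) (suc (T a)) (s≤s z≤n) (s≤s Tc<Ta) (T<k 1≤a)) ,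
      subst₂ _<F_ (sym (ψq 1≤c c≤L)) (sym (ψq 1≤a (≤-trans (<⇒≤ a<c) c≤L)))
        (proj₂ (b-decreasing (T c) (T a) (≤-trans 1≤i (i≤T c≤L)) Tc<Ta (<⇒≤ (T<k 1≤a))))
      where
      1≤c : 1 ≤ c
      1≤c = ≤-trans 1≤a (<⇒≤ a<c)
      Tc<Ta : T c < T a
      Tc<Ta = ∸-monoʳ-< a<c (≤-trans c≤L (s≤s (m∸n≤m j i)))
    q-ends : ψ′ (q L) ≡ π (b i)
    q-ends = trans (ψq (s≤s z≤n) ≤-refl) (cong (π ∘ b) (m∸[m∸n]≡n i≤j))

  b-run-longest : Injective _≡_ _≡_ π → ∀ i j → 1 ≤ i → i ≤ j → j < k → ∀ L q →
                  IsDecFromTo ψ′ (π (b j)) (π (b i)) L q → L ≤ suc (j ∸ i)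
  b-run-longest π-inj (suc i) j _ si≤j j<k zero q (() , _)
  b-run-longest π-inj (suc i) j _ si≤j j<k (suc L) q (_ , dec , starts , ends) =
    s≤s (m+n≤o⇒m≤o∸n L (≤-pred (+-cancelˡ-< g₀ _ _
      (subst₂ _<_ (+-assoc g₀ L (suc i)) (sym g₀+sj≡k) (≰⇒> too-long)))))
    where
    1≤j : 1 ≤ j
    1≤j = ≤-trans (s≤s z≤n) si≤j
    si<k : suc i < k
    si<k = ≤-<-trans si≤j j<k
    g₀ : ℕ
    g₀ = k ∸ suc j
    g₀+sj≡k : g₀ + suc j ≡ k
    g₀+sj≡k = m∸n+n≡m j<k
    q₁≡ : q 1 ≡ b (suc j)
    q₁≡ = ψ-preimage π-inj j 1≤j j<k starts
    start : ChainBehind g₀ (q 1)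
    start = b (suc j) , chain-at-b (suc j) (s≤s z≤n) j<k (≤-reflexive g₀+sj≡k)
          , ≤-reflexive (cong toℕ (sym q₁≡))
          , subst (_≤F π (b (suc j))) (sym starts)
              (<⇒≤ (proj₂ (b-decreasing j (suc j) 1≤j ≤-refl j<k)))
    top : ψ′ (q 1) <F π (b k)
    top = subst (_<F π (b k)) (sym starts) (proj₂ (b-decreasing j k 1≤j j<k ≤-refl))
    too-long : ¬ (k ≤ g₀ + L + suc i)
    too-long k≤ with chainBehind-along q dec top start L ≤-refl
    ... | y , ch , y≤q , ψq≤πy = b-leftmost i (<⇒≤ si<k) k≤ ch y<b above
      where
      qL≡ : q (suc L) ≡ b (suc (suc i))
      qL≡ = ψ-preimage π-inj (suc i) (s≤s z≤n) si<k ends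
      y<b : y <F b (suc i)
      y<b = ≤-<-trans y≤q (subst (_<F b (suc i)) (sym qL≡)
              (proj₁ (b-decreasing (suc i) (suc (suc i)) (s≤s z≤n) ≤-refl si<k)))
      above : 1 ≤ i → π (b i) <F π y
      above 1≤i = <-≤-trans (proj₂ (b-decreasing i (suc i) 1≤i ≤-refl (<⇒≤ si<k)))
                            (subst (_≤F π y) ends ψq≤πy)

lemma38 : ∀ {n} (B : Board n) (π : Fin n → Fin n) → IsFullRook B π →
    ∀ k → 2 ≤ k → (b : ℕ → Fin n) → IsBSeq B π k b →
    ∀ i j → 1 ≤ i → i ≤ j → j < k →
    MaxDecLength (ψ π k b) (π (b j)) (π (b i)) (suc (j ∸ i))
lemma38 B π rook k 2≤k b isBSeq i j 1≤i i≤j j<k =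
  b-run i j 1≤i i≤j j<k , b-run-longest (IsFullRook.inj rook) i j 1≤i i≤j j<k
  where open BSequence B π k (≤-trans (s≤s z≤n) 2≤k) b isBSeq
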